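{- If the clause-set $F$ is acyclic, then $X_0(F)\in\mathcal{PC}$ (where $F$ is interpreted as an XOR-clause-set and $X_0(F)$ as CNF).
   Context: Literals, clauses (finite sets of literals without complementary pairs), clause-sets; $\mathrm{var}$. Partial assignments $\varphi$ and $\varphi*F$ (delete clauses with a true literal, delete false literals); a literal $x$ is forced for $F$ if $\langle x\to0\rangle*F$ is unsatisfiable. $r_1$ is unit-clause propagation; $r_\infty(F)$ is $\{\bot\}$ if $F$ is unsatisfiable, otherwise the result of applying all forced assignments. $\mathcal{PC}$ is the class of clause-sets $G$ with $r_1(\varphi*G)=r_\infty(\varphi*G)$ for all partial assignments $\varphi$. A clause-set $F$ is acyclic if the bipartite graph with parts $\mathrm{var}(F)$ and $F$, where $v$ is adjacent to $C$ iff $v\in\mathrm{var}(C)$, has no cycle. For an XOR-clause $C$ (read as $\bigoplus_{x\in C}x=0$ over $\mathbb{Z}_2$), $X_0(C)$ is the set of all clauses $D$ with $\mathrm{var}(D)=\mathrm{var}(C)$ whose number of complemented literals has parity different from that of $C$; $X_0(F)=\bigcup_{C\in F}X_0(C)$. -}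

module Defs where

open import Data.Nat using (ℕ; zero; suc; _≡ᵇ_; _≤_; NonZero)
open import Data.Nat.DivMod using (_mod_)
open import Data.Bool using (Bool; true; false; not; if_then_else_; _∧_; _∨_; _xor_)
open import Data.Fin using (Fin; toℕ)
open import Data.Maybe using (Maybe; just; nothing)
open import Data.List using (List; []; _∷_; [_]; length; map; concatMap; filterᵇ; lookup)
open import Data.List.Membership.Propositional using (_∈_)
open import Data.List.Relation.Unary.All using (All)
open import Data.List.Relation.Unary.Any using (Any)
open import Data.List.Relation.Unary.Unique.Propositional using (Unique)
open import Data.Product using (Σ; _×_; _,_; proj₁; proj₂; ∃)
open import Data.Sum using (_⊎_)
open import Relation.Nullary using (¬_)
open import Relation.Binary.PropositionalEquality using (_≡_)
open import Function.Definitions using (Injective)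
open import Function.Bundles using (_⇔_)

Var : Set
Var = ℕ

-- A literal is a variable with a sign; sign true = positive literal v,
-- sign false = complemented literal ¬v.
Lit : Set
Lit = Var × Bool

var : Lit → Var
var = proj₁

sign : Lit → Bool
sign = proj₂

-- Clauses are represented by lists of literals (read as finite sets),
-- clause-sets by lists of clauses (read as finite sets).
Clause : Set
Clause = List Lit

ClauseSet : Set
ClauseSet = List Clause

IsClause : Clause → Set
IsClause C = Unique C × (∀ v → ¬ (((v , true) ∈ C) × ((v , false) ∈ C)))

varsC : Clause → List Var
varsC = map var

_≐c_ : Clause → Clause → Set
C ≐c D = ∀ x → (x ∈ C) ⇔ (x ∈ D)

_≐_ : ClauseSet → ClauseSet → Set
F ≐ G = (All (λ C → Any (λ D → C ≐c D) G) F) × (All (λ D → Any (λ C → C ≐c D) F) G)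

PAss : Set
PAss = Var → Maybe Bool

litVal : PAss → Lit → Maybe Bool
litVal φ (v , s) with φ v
... | nothing = nothing
... | just b  = just (not (b xor s))

isTrue : PAss → Lit → Bool
isTrue φ x with litVal φ x
... | just true = true
... | _         = false

isFalse : PAss → Lit → Bool
isFalse φ x with litVal φ x
... | just false = true
... | _          = false

anyᵇ : {A : Set} → (A → Bool) → List A → Bool
anyᵇ p []       = false
anyᵇ p (x ∷ xs) = p x ∨ anyᵇ p xs

allᵇ : {A : Set} → (A → Bool) → List A → Bool
allᵇ p []       = true
allᵇ p (x ∷ xs) = p x ∧ allᵇ p xs

_*_ : PAss → ClauseSet → ClauseSet
φ * [] = []
φ * (C ∷ F) = if anyᵇ (isTrue φ) C
                then φ * F
                else filterᵇ (λ x → not (isFalse φ x)) C ∷ (φ * F)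

⟨_↦_⟩ : Lit → Bool → PAss
⟨ (v , s) ↦ b ⟩ w = if v ≡ᵇ w then just (not (b xor s)) else nothing

satLit : (Var → Bool) → Lit → Set
satLit α (v , s) = α v ≡ s

Sat : ClauseSet → Set
Sat F = ∃ λ (α : Var → Bool) → All (λ C → Any (satLit α) C) F

Unsat : ClauseSet → Set
Unsat F = ¬ Sat F

Forced : ClauseSet → Lit → Set
Forced F x = Unsat (⟨ x ↦ false ⟩ * F)

_==ᴮ_ : Bool → Bool → Bool
a ==ᴮ b = not (a xor b)

_==ᴸ_ : Lit → Lit → Bool
(v , s) ==ᴸ (w , t) = (v ≡ᵇ w) ∧ (s ==ᴮ t)

isEmpty : Clause → Bool
isEmpty [] = true
isEmpty (_ ∷ _) = false

-- a clause is a unit clause {x} iff it is nonempty and all of its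
-- literals equal x
unitLit : Clause → Maybe Lit
unitLit [] = nothing
unitLit (x ∷ xs) = if allᵇ (x ==ᴸ_) xs then just x else nothing

findUnit : ClauseSet → Maybe Lit
findUnit [] = nothing
findUnit (C ∷ F) with unitLit C
... | just x  = just x
... | nothing = findUnit F

-- r₁(F) = {⊥} if ⊥ ∈ F; r₁(⟨x→1⟩ * F) if {x} ∈ F; F otherwise.
-- Each unit step removes at least the unit clause, so the fuel
-- length F suffices (with fuel 0 the clause-set is empty).
r₁-go : ℕ → ClauseSet → ClauseSet
r₁-go zero F = F
r₁-go (suc n) F with anyᵇ isEmpty F
... | true  = [ [] ]
... | false with findUnit F
...   | just x  = r₁-go n (⟨ x ↦ true ⟩ * F)
...   | nothing = F

r₁ : ClauseSet → ClauseSet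
r₁ F = r₁-go (length F) F

-- r_∞ (specified relationally: H is r_∞(F))

IsForcedAssignment : ClauseSet → PAss → Set
IsForcedAssignment F φ = ∀ v b → (φ v ≡ just b) ⇔ Forced F (v , b)

Is-r∞ : ClauseSet → ClauseSet → Set
Is-r∞ F H = (Unsat F × (H ≐ [ [] ]))
          ⊎ (Sat F × Σ PAss (λ φ → IsForcedAssignment F φ × (H ≐ (φ * F))))

PC : ClauseSet → Set
PC G = ∀ (φ : PAss) (H : ClauseSet) → Is-r∞ (φ * G) H → r₁ (φ * G) ≐ H

-- a cycle of length 2k (k = suc (suc m) ≥ 2) in the bipartite
-- variable/clause incidence graph: distinct variables v₀,…,v_{k-1} and
-- distinct clauses C₀,…,C_{k-1} with vᵢ, v_{i+1 mod k} ∈ var(Cᵢ)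
record Cycle (F : ClauseSet) : Set where
  field
    m   : ℕ
    vs  : Fin (suc (suc m)) → Var
    cs  : Fin (suc (suc m)) → Fin (length F)
    vs-inj : Injective _≡_ _≡_ vs
    cs-inj : Injective _≡_ _≡_ cs
    inl : ∀ i → vs i ∈ varsC (lookup F (cs i))
    inr : ∀ i → vs (suc (toℕ i) mod (suc (suc m))) ∈ varsC (lookup F (cs i))

Acyclic : ClauseSet → Set
Acyclic F = ¬ Cycle F

negParity : Clause → Bool
negParity [] = false
negParity (x ∷ xs) = if sign x then negParity xs else not (negParity xs)

allSigns : List Var → List Clause
allSigns [] = [ [] ]
allSigns (v ∷ vs) = concatMap (λ D → ((v , true) ∷ D) ∷ ((v , false) ∷ D) ∷ []) (allSigns vs)

X₀C : Clause → List Clause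
X₀C C = filterᵇ (λ D → negParity D xor negParity C) (allSigns (varsC C))

X₀ : ClauseSet → ClauseSet
X₀ = concatMap X₀C

module Submission where

-- Unit propagation started from φ * G either derives ⊥
--     or stops at some ψ * G with ψ ⊇ φ, ψ implied by G and φ, and ψ * G
--     containing neither the empty clause nor a unit clause.  If in the
--     latter situation every variable can still take every value allowed
--     by ψ in some model of G extending ψ ("G is freely extendable at ψ"),
--     then the forced literals of φ * G are exactly ψ minus φ, and since
--     ψ * G = (ψ ∖ φ) * (φ * G) this gives r₁(φ * G) = r_∞(φ * G).
--     So G ∈ PC whenever G is freely extendable at all its stuck points.
--
-- A model of X₀(F) is a total
--     assignment satisfying all parity constraints of F.  At a stuck point
--     ψ, a constraint with at most one ψ-free variable is satisfied by every
--     extension of ψ (otherwise ψ * X₀(F) would contain an empty or unit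
--     clause).  The constraints with at least two free variables are solved
--     one at a time: acyclicity yields a constraint with a free variable
--     u ≠ v occurring in no other remaining constraint (a walk through a
--     leafless family would close up into a cycle), so the rest can be
--     solved first and the parity then fixed by choosing the value of u.

open import Defs
open import Data.Nat using (ℕ; zero; suc; _≡ᵇ_; _≤_; _<_; _+_; _%_; z≤n; s≤s)
  renaming (_≟_ to _≟ℕ_)
open import Data.Nat.Properties
  using (≡ᵇ⇒≡; ≤-refl; ≤-trans; ≤-pred; m≤n⇒m≤1+n; 1+n≰n; +-suc; +-identityʳ;
         suc-injective; m≤n⇒m<n∨m≡n)
open import Data.Nat.DivMod using (_mod_; m<n⇒m%n≡m; n%n≡0)
open import Data.Fin using (Fin; toℕ; cast) renaming (zero to fzero)
import Data.Fin as Fin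
open import Data.Fin.Properties using (toℕ-injective; toℕ<n; toℕ-cast; toℕ-fromℕ<; injective⇒≤)
  renaming (_≟_ to _≟ᶠ_)
open import Data.Bool using (Bool; true; false; not; if_then_else_; _∧_; _∨_; _xor_)
open import Data.Bool.Properties using (T-≡; xor-same; xor-assoc; xor-identityʳ; xor-inverseʳ; ¬-not; not-¬;
         ∨-commutativeMonoid) renaming (_≟_ to _≟ᵇ_)
open import Algebra.Bundles using (CommutativeMonoid)
open import Algebra.Properties.CommutativeSemigroup
  (CommutativeMonoid.commutativeSemigroup ∨-commutativeMonoid) using () renaming (interchange to ∨-interchange)
open import Data.Maybe using (Maybe; just; nothing; is-nothing)
open import Data.Maybe.Properties using (just-injective)
open import Data.List using (List; []; _∷_; [_]; length; map; filter; filterᵇ; lookup; allFin; _++_)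
open import Data.List.Properties using (filter-notAll; ∷-injectiveˡ)
open import Data.List.Membership.Propositional using (_∈_; find; lose)
open import Data.List.Membership.Propositional.Properties
  using (∈-filter⁺; ∈-filter⁻; ∈-concatMap⁺; ∈-lookup; ∈-allFin; ∈-++⁺ˡ; ∈-++⁺ʳ)
import Data.List.Membership.DecPropositional as DecMembership
open import Data.List.Relation.Unary.All using (All; []; _∷_)
import Data.List.Relation.Unary.All as All
import Data.List.Relation.Unary.All.Properties as All
open import Data.List.Relation.Unary.Any using (Any; here; there; any?)
import Data.List.Relation.Unary.Any as Any
open import Data.List.Relation.Unary.Any.Properties using (lookup-index)
open import Data.List.Relation.Unary.AllPairs using ([]; _∷_)
open import Data.List.Relation.Unary.Unique.Propositional using (Unique)
import Data.List.Relation.Unary.Unique.Propositional.Properties as Unique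
open import Data.Product using (Σ; _×_; _,_; proj₁; proj₂)
open import Data.Sum using (_⊎_; inj₁; inj₂; [_,_]′)
open import Data.Empty using (⊥; ⊥-elim)
open import Function using (_∘_)
open import Function.Bundles using (Equivalence; mk⇔)
open import Relation.Nullary using (¬_; Dec; yes; no)
open import Relation.Nullary.Decidable using (T?; ¬?; _×-dec_)
open import Relation.Binary.PropositionalEquality
  using (_≡_; _≢_; refl; sym; trans; cong; cong₂; subst; module ≡-Reasoning)
open ≡-Reasoning

≡ᵇ-refl : ∀ n → (n ≡ᵇ n) ≡ true
≡ᵇ-refl zero = refl
≡ᵇ-refl (suc n) = ≡ᵇ-refl n

≡ᵇ-true : ∀ m n → (m ≡ᵇ n) ≡ true → m ≡ n
≡ᵇ-true m n e = ≡ᵇ⇒≡ m n (Equivalence.from T-≡ e)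

≡ᵇ-false : ∀ m n → m ≢ n → (m ≡ᵇ n) ≡ false
≡ᵇ-false m n m≢n with m ≡ᵇ n in e
... | false = refl
... | true = ⊥-elim (m≢n (≡ᵇ-true m n e))

maybeCase : (m : Maybe Bool) → (m ≡ nothing) ⊎ (Σ Bool λ c → m ≡ just c)
maybeCase nothing = inj₁ refl
maybeCase (just c) = inj₂ (c , refl)

if-true : ∀ {A : Set} {b : Bool} {x y : A} → b ≡ true → (if b then x else y) ≡ x
if-true refl = refl

not-true : ∀ {b} → not b ≡ true → b ≡ false
not-true {false} _ = refl

xnor-true : ∀ c s → not (c xor s) ≡ true → c ≡ s
xnor-true true true _ = refl
xnor-true false false _ = refl

not≢self : ∀ c → not c ≢ c
not≢self c e = not-¬ refl (sym e)

module _ {A : Set} (p : A → Bool) where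

  ∈-filterᵇ⁺ : ∀ {x xs} → x ∈ xs → p x ≡ true → x ∈ filterᵇ p xs
  ∈-filterᵇ⁺ x∈xs px = ∈-filter⁺ (T? ∘ p) x∈xs (Equivalence.from T-≡ px)

  ∈-filterᵇ⁻ : ∀ {x} xs → x ∈ filterᵇ p xs → x ∈ xs × p x ≡ true
  ∈-filterᵇ⁻ xs m with ∈-filter⁻ (T? ∘ p) {xs = xs} m
  ... | x∈xs , px = x∈xs , Equivalence.to T-≡ px

  filterᵇ-accept : ∀ {x} xs → p x ≡ true → filterᵇ p (x ∷ xs) ≡ x ∷ filterᵇ p xs
  filterᵇ-accept xs px rewrite px = refl

  filterᵇ-reject : ∀ {x} xs → p x ≡ false → filterᵇ p (x ∷ xs) ≡ filterᵇ p xs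
  filterᵇ-reject xs px rewrite px = refl

  All-filterᵇ : ∀ {P : A → Set} {xs} → (∀ {y} → y ∈ xs → p y ≡ true → P y) → All P (filterᵇ p xs)
  All-filterᵇ {xs = xs} h = All.tabulate λ m → let (y∈xs , py) = ∈-filterᵇ⁻ xs m in h y∈xs py

  Any-filterᵇ⁺ : ∀ {P : A → Set} {xs} → Any P xs → (∀ {y} → P y → p y ≡ true) → Any P (filterᵇ p xs)
  Any-filterᵇ⁺ a h with find a
  ... | y , y∈xs , py = lose (∈-filterᵇ⁺ y∈xs (h py)) py

  anyᵇ⁻ : ∀ xs → anyᵇ p xs ≡ true → Any (λ y → p y ≡ true) xs
  anyᵇ⁻ (x ∷ xs) e with p x in px
  ... | true = here px
  ... | false = there (anyᵇ⁻ xs e)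

  noneᵇ⁻ : ∀ xs → anyᵇ p xs ≡ false → All (λ y → p y ≡ false) xs
  noneᵇ⁻ [] e = []
  noneᵇ⁻ (x ∷ xs) e with p x in px
  ... | false = px ∷ noneᵇ⁻ xs e

  anyᵇ⁺ : ∀ {x xs} → x ∈ xs → p x ≡ true → anyᵇ p xs ≡ true
  anyᵇ⁺ (here refl) px rewrite px = refl
  anyᵇ⁺ {xs = y ∷ ys} (there m) px rewrite anyᵇ⁺ m px with p y
  ... | true = refl
  ... | false = refl

module _ {A : Set} where

  anyᵇ-cong : ∀ (p q : A → Bool) xs → (∀ y → p y ≡ q y) → anyᵇ p xs ≡ anyᵇ q xs
  anyᵇ-cong p q [] h = refl
  anyᵇ-cong p q (x ∷ xs) h = cong₂ _∨_ (h x) (anyᵇ-cong p q xs h)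

  filterᵇ-cong : ∀ (p q : A → Bool) xs → (∀ y → p y ≡ q y) → filterᵇ p xs ≡ filterᵇ q xs
  filterᵇ-cong p q [] h = refl
  filterᵇ-cong p q (x ∷ xs) h with p x in px
  ... | true rewrite filterᵇ-accept q xs (trans (sym (h x)) px) = cong (x ∷_) (filterᵇ-cong p q xs h)
  ... | false rewrite filterᵇ-reject q xs (trans (sym (h x)) px) = filterᵇ-cong p q xs h

module _ (ρ : PAss) (v : Var) (s : Bool) where

  isTrue-assigned : ∀ {c} → ρ v ≡ just c → isTrue ρ (v , s) ≡ not (c xor s)
  isTrue-assigned {c} e rewrite e with not (c xor s)
  ... | true = refl
  ... | false = refl

  isFalse-assigned : ∀ {c} → ρ v ≡ just c → isFalse ρ (v , s) ≡ c xor s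
  isFalse-assigned {c} e rewrite e with c xor s
  ... | true = refl
  ... | false = refl

  isTrue-unassigned : ρ v ≡ nothing → isTrue ρ (v , s) ≡ false
  isTrue-unassigned e rewrite e = refl

  isFalse-unassigned : ρ v ≡ nothing → isFalse ρ (v , s) ≡ false
  isFalse-unassigned e rewrite e = refl

lit-cong : ∀ ρ ρ' y → ρ (var y) ≡ ρ' (var y) →
           (isTrue ρ y ≡ isTrue ρ' y) × (isFalse ρ y ≡ isFalse ρ' y)
lit-cong ρ ρ' (v , s) e with maybeCase (ρ' v)
... | inj₁ e' = trans (isTrue-unassigned ρ v s (trans e e')) (sym (isTrue-unassigned ρ' v s e'))
              , trans (isFalse-unassigned ρ v s (trans e e')) (sym (isFalse-unassigned ρ' v s e'))
... | inj₂ (c , e') = trans (isTrue-assigned ρ v s (trans e e')) (sym (isTrue-assigned ρ' v s e'))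
                    , trans (isFalse-assigned ρ v s (trans e e')) (sym (isFalse-assigned ρ' v s e'))

neither-true-nor-false : ∀ ρ y → isTrue ρ y ≡ false → isFalse ρ y ≡ false → ρ (var y) ≡ nothing
neither-true-nor-false ρ (v , s) t f with maybeCase (ρ v)
... | inj₁ e = e
... | inj₂ (c , e) rewrite isTrue-assigned ρ v s e | isFalse-assigned ρ v s e with c xor s
neither-true-nor-false ρ (v , s) () f | inj₂ _ | false
neither-true-nor-false ρ (v , s) t () | inj₂ _ | true

Models : (Var → Bool) → ClauseSet → Set
Models α F = All (λ C → Any (satLit α) C) F

Agree : (Var → Bool) → PAss → Set
Agree α ρ = ∀ v b → ρ v ≡ just b → α v ≡ b

complete : PAss → (Var → Bool) → Var → Bool
complete ρ α v with ρ v
... | just b = b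
... | nothing = α v

complete-assigned : ∀ ρ α {v b} → ρ v ≡ just b → complete ρ α v ≡ b
complete-assigned ρ α e rewrite e = refl

complete-unassigned : ∀ ρ α {v} → ρ v ≡ nothing → complete ρ α v ≡ α v
complete-unassigned ρ α e rewrite e = refl

complete-agrees : ∀ ρ α → Agree (complete ρ α) ρ
complete-agrees ρ α v b = complete-assigned ρ α

-- Soundness of φ * F: a model of F extending ρ is a model of ρ * F
-- (a satisfied literal is never deleted).
models-star : ∀ α ρ F → Models α F → Agree α ρ → Models α (ρ * F)
models-star α ρ [] [] ag = []
models-star α ρ (C ∷ F) (sat ∷ sats) ag with anyᵇ (isTrue ρ) C
... | true = models-star α ρ F sats ag
... | false = Any-filterᵇ⁺ _ sat (cong not ∘ not-false _) ∷ models-star α ρ F sats ag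
  where
  not-false : ∀ y → satLit α y → isFalse ρ y ≡ false
  not-false (v , s) sl with maybeCase (ρ v)
  ... | inj₁ e = isFalse-unassigned ρ v s e
  ... | inj₂ (c , e) = begin
    isFalse ρ (v , s)  ≡⟨ isFalse-assigned ρ v s e ⟩
    c xor s            ≡⟨ cong (c xor_) (trans (sym sl) (ag v c e)) ⟩
    c xor c            ≡⟨ xor-same c ⟩
    false              ∎

models-unstar : ∀ α ρ F → Models α (ρ * F) → Models (complete ρ α) F
models-unstar α ρ [] _ = []
models-unstar α ρ (C ∷ F) m with anyᵇ (isTrue ρ) C in e
... | true = Any.map (true-sat _) (anyᵇ⁻ (isTrue ρ) C e) ∷ models-unstar α ρ F m
  where
  true-sat : ∀ y → isTrue ρ y ≡ true → satLit (complete ρ α) y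
  true-sat (v , s) t with maybeCase (ρ v)
  ... | inj₁ e' with trans (sym (isTrue-unassigned ρ v s e')) t
  ... | ()
  true-sat (v , s) t | inj₂ (c , e') =
    trans (complete-assigned ρ α e') (xnor-true c s (trans (sym (isTrue-assigned ρ v s e')) t))
models-unstar α ρ (C ∷ F) (sat ∷ sats) | false with find sat
... | y , y∈ , sy with ∈-filterᵇ⁻ _ C y∈
...   | y∈C , nf = lose y∈C (subst (_≡ sign y) (sym α-agrees) sy) ∷ models-unstar α ρ F sats
  where
  α-agrees : complete ρ α (var y) ≡ α (var y)
  α-agrees = complete-unassigned ρ α
    (neither-true-nor-false ρ y (All.lookup (noneᵇ⁻ (isTrue ρ) C e) y∈C) (not-true nf))

_∪_ : PAss → PAss → PAss
(ρ₁ ∪ ρ₂) v with ρ₁ v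
... | just b = just b
... | nothing = ρ₂ v

∪-assigned : ∀ ρ₁ ρ₂ {v b} → ρ₁ v ≡ just b → (ρ₁ ∪ ρ₂) v ≡ just b
∪-assigned ρ₁ ρ₂ e rewrite e = refl

∪-unassigned : ∀ ρ₁ ρ₂ {v} → ρ₁ v ≡ nothing → (ρ₁ ∪ ρ₂) v ≡ ρ₂ v
∪-unassigned ρ₁ ρ₂ e rewrite e = refl

notFalse : PAss → Lit → Bool
notFalse ρ y = not (isFalse ρ y)

isTrue-∪ : ∀ ρ₁ ρ₂ y → isTrue (ρ₁ ∪ ρ₂) y ≡ isTrue ρ₁ y ∨ (notFalse ρ₁ y ∧ isTrue ρ₂ y)
isTrue-∪ ρ₁ ρ₂ (v , s) with maybeCase (ρ₁ v)
... | inj₁ e rewrite isTrue-unassigned ρ₁ v s e | isFalse-unassigned ρ₁ v s e =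
  proj₁ (lit-cong (ρ₁ ∪ ρ₂) ρ₂ (v , s) (∪-unassigned ρ₁ ρ₂ e))
... | inj₂ (c , e) rewrite isTrue-assigned ρ₁ v s e | isFalse-assigned ρ₁ v s e
                         | isTrue-assigned (ρ₁ ∪ ρ₂) v s (∪-assigned ρ₁ ρ₂ e) with c xor s
... | true = refl
... | false = refl

notFalse-∪ : ∀ ρ₁ ρ₂ y → isTrue ρ₁ y ≡ false →
             notFalse (ρ₁ ∪ ρ₂) y ≡ notFalse ρ₁ y ∧ notFalse ρ₂ y
notFalse-∪ ρ₁ ρ₂ (v , s) t with maybeCase (ρ₁ v)
... | inj₁ e rewrite isFalse-unassigned ρ₁ v s e =
  cong not (proj₂ (lit-cong (ρ₁ ∪ ρ₂) ρ₂ (v , s) (∪-unassigned ρ₁ ρ₂ e)))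
... | inj₂ (c , e) rewrite isTrue-assigned ρ₁ v s e | isFalse-assigned ρ₁ v s e
                         | isFalse-assigned (ρ₁ ∪ ρ₂) v s (∪-assigned ρ₁ ρ₂ e) with c xor s
... | true = refl

module _ {A : Set} (g a b c : A → Bool) where

  anyᵇ-split : ∀ xs → (∀ y → g y ≡ a y ∨ (b y ∧ c y)) →
               anyᵇ g xs ≡ anyᵇ a xs ∨ anyᵇ c (filterᵇ b xs)
  anyᵇ-split [] h = refl
  anyᵇ-split (x ∷ xs) h with b x in bx
  ... | true = begin
    g x ∨ anyᵇ g xs
      ≡⟨ cong₂ _∨_ (trans (h x) (cong (λ t → a x ∨ (t ∧ c x)) bx)) (anyᵇ-split xs h) ⟩
    (a x ∨ c x) ∨ (anyᵇ a xs ∨ anyᵇ c (filterᵇ b xs))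
      ≡⟨ ∨-interchange (a x) (c x) (anyᵇ a xs) _ ⟩
    (a x ∨ anyᵇ a xs) ∨ (c x ∨ anyᵇ c (filterᵇ b xs)) ∎
  ... | false = begin
    g x ∨ anyᵇ g xs
      ≡⟨ cong₂ _∨_ (trans (h x) (cong (λ t → a x ∨ (t ∧ c x)) bx)) (anyᵇ-split xs h) ⟩
    (a x ∨ false) ∨ (anyᵇ a xs ∨ anyᵇ c (filterᵇ b xs))
      ≡⟨ ∨-interchange (a x) false (anyᵇ a xs) _ ⟩
    (a x ∨ anyᵇ a xs) ∨ anyᵇ c (filterᵇ b xs) ∎

  filterᵇ-split : ∀ xs → anyᵇ a xs ≡ false → (∀ y → a y ≡ false → g y ≡ b y ∧ c y) →
                  filterᵇ g xs ≡ filterᵇ c (filterᵇ b xs)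
  filterᵇ-split [] _ _ = refl
  filterᵇ-split (x ∷ xs) none h with a x in ax
  ... | false with b x in bx
  ...   | false rewrite filterᵇ-reject g xs (trans (h x ax) (cong (_∧ c x) bx)) =
    filterᵇ-split xs none h
  ...   | true with c x in cx
  ...     | false rewrite filterᵇ-reject g xs (trans (h x ax) (cong₂ _∧_ bx cx)) =
    filterᵇ-split xs none h
  ...     | true rewrite filterᵇ-accept g xs (trans (h x ax) (cong₂ _∧_ bx cx)) =
    cong (x ∷_) (filterᵇ-split xs none h)

star-∪ : ∀ ρ₁ ρ₂ F → ρ₂ * (ρ₁ * F) ≡ (ρ₁ ∪ ρ₂) * F
star-∪ ρ₁ ρ₂ [] = refl
star-∪ ρ₁ ρ₂ (C ∷ F)
  rewrite anyᵇ-split (isTrue (ρ₁ ∪ ρ₂)) (isTrue ρ₁) (notFalse ρ₁) (isTrue ρ₂) C (isTrue-∪ ρ₁ ρ₂)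
  with anyᵇ (isTrue ρ₁) C in sat₁
... | true = star-∪ ρ₁ ρ₂ F
... | false with anyᵇ (isTrue ρ₂) (filterᵇ (notFalse ρ₁) C)
...   | true = star-∪ ρ₁ ρ₂ F
...   | false = cong₂ _∷_
  (sym (filterᵇ-split (notFalse (ρ₁ ∪ ρ₂)) (isTrue ρ₁) (notFalse ρ₁) (notFalse ρ₂) C sat₁ (notFalse-∪ ρ₁ ρ₂)))
  (star-∪ ρ₁ ρ₂ F)

star-cong : ∀ ρ ρ' F → (∀ v → ρ v ≡ ρ' v) → ρ * F ≡ ρ' * F
star-cong ρ ρ' [] h = refl
star-cong ρ ρ' (C ∷ F) h
  rewrite anyᵇ-cong (isTrue ρ) (isTrue ρ') C (λ y → proj₁ (lit-cong ρ ρ' y (h (var y))))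
  with anyᵇ (isTrue ρ') C
... | true = star-cong ρ ρ' F h
... | false = cong₂ _∷_ (filterᵇ-cong _ _ C (λ y → cong not (proj₂ (lit-cong ρ ρ' y (h (var y))))))
                        (star-cong ρ ρ' F h)

star-length : ∀ ρ F → length (ρ * F) ≤ length F
star-length ρ [] = z≤n
star-length ρ (C ∷ F) with anyᵇ (isTrue ρ) C
... | true = m≤n⇒m≤1+n (star-length ρ F)
... | false = s≤s (star-length ρ F)

star-length< : ∀ ρ {C} F → C ∈ F → anyᵇ (isTrue ρ) C ≡ true → length (ρ * F) < length F
star-length< ρ (C ∷ F) (here refl) sat rewrite sat = s≤s (star-length ρ F)
star-length< ρ (D ∷ F) (there C∈F) sat with anyᵇ (isTrue ρ) D
... | true = m≤n⇒m≤1+n (star-length< ρ F C∈F sat)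
... | false = s≤s (star-length< ρ F C∈F sat)

≡ᴸ-true : ∀ x z → (x ==ᴸ z) ≡ true → x ≡ z
≡ᴸ-true (v , s) (w , t) e with v ≡ᵇ w in vw
≡ᴸ-true (v , s) (w , t) e | true with ≡ᵇ-true v w vw | s | t | e
... | refl | true | true | _ = refl
... | refl | false | false | _ = refl

unitLit-shape : ∀ C {x} → unitLit C ≡ just x → Σ (List Lit) λ ys → C ≡ x ∷ ys × All (_≡ x) ys
unitLit-shape (y ∷ ys) e with allᵇ (y ==ᴸ_) ys in all-y
unitLit-shape (y ∷ ys) refl | true = ys , refl , all-equal ys all-y
  where
  all-equal : ∀ zs → allᵇ (y ==ᴸ_) zs ≡ true → All (_≡ y) zs
  all-equal [] _ = []
  all-equal (z ∷ zs) e with y ==ᴸ z in yz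
  ... | true = sym (≡ᴸ-true y z yz) ∷ all-equal zs e

unitLit-∈ : ∀ C {x} → unitLit C ≡ just x → x ∈ C
unitLit-∈ C e with unitLit-shape C e
... | _ , refl , _ = here refl

unitLit-sat : ∀ α C {x} → unitLit C ≡ just x → Any (satLit α) C → satLit α x
unitLit-sat α C e sat with unitLit-shape C e
... | ys , refl , copies with find sat
... | _ , here refl , sy = sy
... | _ , there y∈ys , sy = subst (satLit α) (All.lookup copies y∈ys) sy

findUnit-sound : ∀ K {x} → findUnit K ≡ just x → Σ Clause λ C → C ∈ K × unitLit C ≡ just x
findUnit-sound (C ∷ K) e with unitLit C in u
findUnit-sound (C ∷ K) refl | just _ = C , here refl , u
... | nothing with findUnit-sound K e
...   | D , D∈K , uD = D , there D∈K , uD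

findUnit-complete : ∀ K {x} → [ x ] ∈ K → Σ Lit λ z → findUnit K ≡ just z
findUnit-complete ((x ∷ []) ∷ K) (here refl) = x , refl
findUnit-complete (D ∷ K) (there m) with unitLit D
... | just z = z , refl
... | nothing = findUnit-complete K m

Stuck : ClauseSet → Set
Stuck K = anyᵇ isEmpty K ≡ false × findUnit K ≡ nothing

stuck-no-empty : ∀ {K} → Stuck K → ¬ ([] ∈ K)
stuck-no-empty (none , _) []∈K with trans (sym (anyᵇ⁺ isEmpty []∈K refl)) none
... | ()

stuck-no-unit : ∀ {K x} → Stuck K → ¬ ([ x ] ∈ K)
stuck-no-unit {K} (_ , no-unit) unit∈K with findUnit-complete K unit∈K
... | _ , found with trans (sym found) no-unit
... | ()

empty-stuck : ∀ K → length K ≤ 0 → Stuck K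
empty-stuck [] _ = refl , refl

Extends : PAss → PAss → Set
Extends ψ φ = ∀ v b → φ v ≡ just b → ψ v ≡ just b

Implied : ClauseSet → PAss → PAss → Set
Implied G φ ψ = ∀ α → Models α G → Agree α φ → Agree α ψ

agree-extends : ∀ {α ψ φ} → Agree α ψ → Extends ψ φ → Agree α φ
agree-extends ag ext v b e = ag v b (ext v b e)

∪-agrees : ∀ α ρ₁ ρ₂ → Agree α ρ₁ → Agree α ρ₂ → Agree α (ρ₁ ∪ ρ₂)
∪-agrees α ρ₁ ρ₂ ag₁ ag₂ v b e with maybeCase (ρ₁ v)
... | inj₁ e₁ = ag₂ v b (trans (sym (∪-unassigned ρ₁ ρ₂ e₁)) e)
... | inj₂ (c , e₁) with trans (sym (∪-assigned ρ₁ ρ₂ e₁)) e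
... | refl = ag₁ v c e₁

unit-makes-true : ∀ x → isTrue ⟨ x ↦ true ⟩ x ≡ true
unit-makes-true (v , s) rewrite isTrue-assigned ⟨ (v , s) ↦ true ⟩ v s (if-true (≡ᵇ-refl v)) with s
... | true = refl
... | false = refl

unit-agrees : ∀ α x → satLit α x → Agree α ⟨ x ↦ true ⟩
unit-agrees α (v , s) sx w b e with v ≡ᵇ w in vw
unit-agrees α (v , s) sx w b refl | true with ≡ᵇ-true v w vw | s
... | refl | true = sx
... | refl | false = sx

data Propagation (G : ClauseSet) (φ : PAss) (K : ClauseSet) : Set where
  conflict : ∀ ψ → Extends ψ φ → Implied G φ ψ → anyᵇ isEmpty (ψ * G) ≡ true →
             K ≡ [ [] ] → Propagation G φ K
  fixpoint : ∀ ψ → Extends ψ φ → Implied G φ ψ → Stuck (ψ * G) →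
             K ≡ ψ * G → Propagation G φ K

propagate : ∀ G φ n ψ → length (ψ * G) ≤ n → Extends ψ φ → Implied G φ ψ →
            Propagation G φ (r₁-go n (ψ * G))
propagate G φ zero ψ len ext imp = fixpoint ψ ext imp (empty-stuck (ψ * G) len) refl
propagate G φ (suc n) ψ len ext imp with anyᵇ isEmpty (ψ * G) in has-empty
... | true = conflict ψ ext imp has-empty refl
... | false with findUnit (ψ * G) in unit
...   | nothing = fixpoint ψ ext imp (has-empty , unit) refl
...   | just x with findUnit-sound (ψ * G) unit
...     | C , C∈K , unitC =
  subst (Propagation G φ ∘ r₁-go n) (sym (star-∪ ψ ⟨ x ↦ true ⟩ G))
        (propagate G φ n ψ' len' ext' imp')
  where
  ψ' : PAss
  ψ' = ψ ∪ ⟨ x ↦ true ⟩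
  len' : length (ψ' * G) ≤ n
  len' = ≤-pred (subst (λ K → suc (length K) ≤ suc n) (star-∪ ψ ⟨ x ↦ true ⟩ G)
           (≤-trans (star-length< ⟨ x ↦ true ⟩ (ψ * G) C∈K
                      (anyᵇ⁺ (isTrue ⟨ x ↦ true ⟩) (unitLit-∈ C unitC) (unit-makes-true x))) len))
  ext' : Extends ψ' φ
  ext' v b e = ∪-assigned ψ ⟨ x ↦ true ⟩ (ext v b e)
  imp' : Implied G φ ψ'
  imp' α models ag = ∪-agrees α ψ ⟨ x ↦ true ⟩ (imp α models ag)
    (unit-agrees α x (unitLit-sat α C unitC (All.lookup (models-star α ψ G models (imp α models ag)) C∈K)))

complete-model : ∀ G φ β → Models β (φ * G) → Models (complete φ β) G × Agree (complete φ β) φ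
complete-model G φ β m = models-unstar β φ G m , complete-agrees φ β

has-empty-unsat : ∀ α K → anyᵇ isEmpty K ≡ true → ¬ Models α K
has-empty-unsat α K has-empty m with find (anyᵇ⁻ isEmpty K has-empty)
... | [] , []∈K , _ with find (All.lookup m []∈K)
... | _ , () , _

implied-conflict : ∀ G φ ψ → Implied G φ ψ → anyᵇ isEmpty (ψ * G) ≡ true → Unsat (φ * G)
implied-conflict G φ ψ imp has-empty (β , m) =
  let α = complete φ β
      (mα , agα) = complete-model G φ β m
  in has-empty-unsat α (ψ * G) has-empty (models-star α ψ G mα (imp α mα agα))

falsify-value : ∀ w c → ⟨ (w , c) ↦ false ⟩ w ≡ just (not c)
falsify-value w c = if-true (≡ᵇ-refl w)

falsify-agrees : ∀ α w c → α w ≡ not c → Agree α ⟨ (w , c) ↦ false ⟩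
falsify-agrees α w c αw u d e with w ≡ᵇ u in wu
falsify-agrees α w c αw u d refl | true with ≡ᵇ-true w u wu
... | refl = αw

forced-sound : ∀ F w c → Forced F (w , c) → ∀ α → Models α F → α w ≡ c
forced-sound F w c forced α m with α w ≟ᵇ c
... | yes αw = αw
... | no αw≢c = ⊥-elim (forced (α , models-star α ⟨ (w , c) ↦ false ⟩ F m (falsify-agrees α w c (¬-not αw≢c))))

forced-complete : ∀ F w c → (∀ α → Models α F → α w ≡ c) → Forced F (w , c)
forced-complete F w c all-c (β , m) = not≢self c (begin
  not c                     ≡⟨ sym (complete-assigned ρ β (falsify-value w c)) ⟩
  complete ρ β w            ≡⟨ all-c (complete ρ β) (models-unstar β ρ F m) ⟩
  c                         ∎)
  where
  ρ : PAss
  ρ = ⟨ (w , c) ↦ false ⟩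

Permits : PAss → Var → Bool → Set
Permits ψ v b = (ψ v ≡ nothing) ⊎ (ψ v ≡ just b)

permitted : ∀ ψ v → Σ Bool (Permits ψ v)
permitted ψ v with maybeCase (ψ v)
... | inj₁ e = false , inj₁ e
... | inj₂ (c , e) = c , inj₂ e

FreelyExtendable : ClauseSet → PAss → Set
FreelyExtendable G ψ =
  ∀ v b → Permits ψ v b → Σ (Var → Bool) λ α → Models α G × Agree α ψ × α v ≡ b

≐c-sym : ∀ {C D} → C ≐c D → D ≐c C
≐c-sym C≐D x = mk⇔ (Equivalence.from (C≐D x)) (Equivalence.to (C≐D x))

≐-sym : ∀ {F G} → F ≐ G → G ≐ F
≐-sym (F⊆G , G⊆F) = All.map (Any.map ≐c-sym) G⊆F , All.map (Any.map ≐c-sym) F⊆G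

module _ (G : ClauseSet) (φ ψ : PAss) (ext : Extends ψ φ) (imp : Implied G φ ψ)
         (free : FreelyExtendable G ψ) where

  -- a model of G extending ψ (at any variable, say 0) satisfies φ * G
  free-sat : Sat (φ * G)
  free-sat with permitted ψ 0
  ... | b , p with free 0 b p
  ...   | α , m , ag , _ = α , models-star α φ G m (agree-extends ag ext)

  forced-by-ψ : ∀ φ' → IsForcedAssignment (φ * G) φ' → ∀ w → ψ w ≡ (φ ∪ φ') w
  forced-by-ψ φ' is-forced w with maybeCase (φ w)
  ... | inj₂ (c , φw) = trans (ext w c φw) (sym (∪-assigned φ φ' φw))
  ... | inj₁ φw with maybeCase (ψ w)
  ...   | inj₂ (c , ψw) =
    trans ψw (sym (trans (∪-unassigned φ φ' φw) (Equivalence.from (is-forced w c) c-forced)))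
    where
    c-forced : Forced (φ * G) (w , c)
    c-forced = forced-complete (φ * G) w c λ β m →
      let α = complete φ β
          (mα , agα) = complete-model G φ β m
      in trans (sym (complete-unassigned φ β φw)) (imp α mα agα w c ψw)
  ...   | inj₁ ψw = trans ψw (sym (trans (∪-unassigned φ φ' φw) φ'w))
    where
    φ'w : φ' w ≡ nothing
    φ'w with maybeCase (φ' w)
    ... | inj₁ e = e
    ... | inj₂ (c , e) with free w (not c) (inj₁ ψw)
    ...   | α , m , ag , αw = ⊥-elim (not≢self c (trans (sym αw)
      (forced-sound (φ * G) w c (Equivalence.to (is-forced w c) e) α
                    (models-star α φ G m (agree-extends ag ext)))))

PC-criterion : ∀ G → (∀ ψ → Stuck (ψ * G) → FreelyExtendable G ψ) → PC G
PC-criterion G free-at φ H r∞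
  with propagate G φ (length (φ * G)) φ ≤-refl (λ _ _ e → e) (λ _ _ ag → ag)
... | conflict ψ _ imp has-empty r₁≡⊥ with r∞
...   | inj₁ (_ , H≐⊥) = subst (_≐ H) (sym r₁≡⊥) (≐-sym H≐⊥)
...   | inj₂ (sat , _) = ⊥-elim (implied-conflict G φ ψ imp has-empty sat)
PC-criterion G free-at φ H r∞
    | fixpoint ψ ext imp stuck r₁≡ψG with r∞
...   | inj₁ (unsat , _) = ⊥-elim (unsat (free-sat G φ ψ ext imp (free-at ψ stuck)))
...   | inj₂ (_ , φ' , is-forced , H≐) = subst (_≐ H) (sym r₁≡φ'φG) (≐-sym H≐)
  where
  r₁≡φ'φG : r₁ (φ * G) ≡ φ' * (φ * G)
  r₁≡φ'φG = begin
    r₁ (φ * G)      ≡⟨ r₁≡ψG ⟩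
    ψ * G           ≡⟨ star-cong ψ (φ ∪ φ') G (forced-by-ψ G φ ψ ext imp (free-at ψ stuck) φ' is-forced) ⟩
    (φ ∪ φ') * G    ≡⟨ sym (star-∪ φ φ' G) ⟩
    φ' * (φ * G)    ∎

-- XOR semantics.  α satisfies the XOR-clause C iff the parity of α on
-- var(C) equals the parity of the number of complemented literals of C.

parity : (Var → Bool) → List Var → Bool
parity α [] = false
parity α (w ∷ ws) = α w xor parity α ws

SatX : (Var → Bool) → Clause → Set
SatX α C = parity α (varsC C) ≡ negParity C

parity-cong : ∀ α β vs → (∀ {w} → w ∈ vs → α w ≡ β w) → parity α vs ≡ parity β vs
parity-cong α β [] h = refl
parity-cong α β (w ∷ ws) h = cong₂ _xor_ (h (here refl)) (parity-cong α β ws (h ∘ there))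

-- The only clause over vs falsified by α is the one with literals ¬α(w);
-- its number of complemented literals has the parity of α on vs.
allSigns-sat : ∀ α vs → All (λ D → Any (satLit α) D ⊎ negParity D ≡ parity α vs) (allSigns vs)
allSigns-sat α [] = inj₂ refl ∷ []
allSigns-sat α (v ∷ vs) = All.concat⁺ (All.map⁺ (All.map extend (allSigns-sat α vs)))
  where
  extend : ∀ {D} → Any (satLit α) D ⊎ negParity D ≡ parity α vs →
           All (λ D' → Any (satLit α) D' ⊎ negParity D' ≡ parity α (v ∷ vs))
               (((v , true) ∷ D) ∷ ((v , false) ∷ D) ∷ [])
  extend q with α v in αv | q
  ... | true | inj₁ sat = inj₁ (here αv) ∷ inj₁ (there sat) ∷ []
  ... | true | inj₂ p = inj₁ (here αv) ∷ inj₂ (cong not p) ∷ []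
  ... | false | inj₁ sat = inj₁ (there sat) ∷ inj₁ (here αv) ∷ []
  ... | false | inj₂ p = inj₂ p ∷ inj₁ (here αv) ∷ []

X₀C-sound : ∀ α C → SatX α C → Models α (X₀C C)
X₀C-sound α C sat = All-filterᵇ _ λ {D} D∈ odd → sat-or-parity (All.lookup (allSigns-sat α (varsC C)) D∈) odd
  where
  sat-or-parity : ∀ {D} → Any (satLit α) D ⊎ negParity D ≡ parity α (varsC C) →
                  (negParity D xor negParity C) ≡ true → Any (satLit α) D
  sat-or-parity (inj₁ a) _ = a
  sat-or-parity {D} (inj₂ p) odd rewrite p | sat | xor-same (negParity C) with odd
  ... | ()

X₀-sound : ∀ α F → (∀ {C} → C ∈ F → SatX α C) → Models α (X₀ F)
X₀-sound α F sat = All.concat⁺ (All.map⁺ (All.tabulate λ {C} C∈F → X₀C-sound α C (sat C∈F)))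

X₀C⊆X₀ : ∀ F {C D} → C ∈ F → D ∈ X₀C C → D ∈ X₀ F
X₀C⊆X₀ F C∈F D∈ = ∈-concatMap⁺ X₀C (Any.map (λ { refl → D∈ }) C∈F)

falsifier : (Var → Bool) → List Var → Clause
falsifier α = map (λ w → (w , not (α w)))

falsifier-∈ : ∀ α vs → falsifier α vs ∈ allSigns vs
falsifier-∈ α [] = here refl
falsifier-∈ α (v ∷ vs) =
  ∈-concatMap⁺ (λ D → ((v , true) ∷ D) ∷ ((v , false) ∷ D) ∷ [])
                (Any.map (λ { refl → with-sign (α v) }) (falsifier-∈ α vs))
  where
  with-sign : ∀ b → ((v , not b) ∷ falsifier α vs)
                    ∈ (((v , true) ∷ falsifier α vs) ∷ ((v , false) ∷ falsifier α vs) ∷ [])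
  with-sign false = here refl
  with-sign true = there (here refl)

negParity-falsifier : ∀ α vs → negParity (falsifier α vs) ≡ parity α vs
negParity-falsifier α [] = refl
negParity-falsifier α (w ∷ ws) with α w
... | true = cong not (negParity-falsifier α ws)
... | false = negParity-falsifier α ws

falsifier-∈-X₀C : ∀ α C → ¬ SatX α C → falsifier α (varsC C) ∈ X₀C C
falsifier-∈-X₀C α C unsat = ∈-filterᵇ⁺ _ (falsifier-∈ α (varsC C)) (begin
  negParity (falsifier α (varsC C)) xor negParity C   ≡⟨ cong (_xor negParity C) (negParity-falsifier α (varsC C)) ⟩
  parity α (varsC C) xor negParity C                  ≡⟨ cong (parity α (varsC C) xor_) (¬-not (unsat ∘ sym)) ⟩
  parity α (varsC C) xor not (parity α (varsC C))     ≡⟨ xor-inverseʳ (parity α (varsC C)) ⟩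
  true                                                ∎)

Unassigned : PAss → Var → Bool
Unassigned ψ w = is-nothing (ψ w)

freeVars : PAss → Clause → List Var
freeVars ψ C = filterᵇ (Unassigned ψ) (varsC C)

falsifier-not-true : ∀ ψ α vs → Agree α ψ → anyᵇ (isTrue ψ) (falsifier α vs) ≡ false
falsifier-not-true ψ α [] ag = refl
falsifier-not-true ψ α (w ∷ ws) ag with maybeCase (ψ w)
... | inj₁ e rewrite isTrue-unassigned ψ w (not (α w)) e = falsifier-not-true ψ α ws ag
... | inj₂ (c , e) rewrite isTrue-assigned ψ w (not (α w)) e | ag w c e | xor-inverseʳ c =
  falsifier-not-true ψ α ws ag

falsifier-star : ∀ ψ α vs → Agree α ψ →
                 filterᵇ (notFalse ψ) (falsifier α vs) ≡ falsifier α (filterᵇ (Unassigned ψ) vs)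
falsifier-star ψ α [] ag = refl
falsifier-star ψ α (w ∷ ws) ag with maybeCase (ψ w)
... | inj₁ e rewrite isFalse-unassigned ψ w (not (α w)) e | e =
  cong ((w , not (α w)) ∷_) (falsifier-star ψ α ws ag)
... | inj₂ (c , e) rewrite isFalse-assigned ψ w (not (α w)) e | ag w c e | e | xor-inverseʳ c =
  falsifier-star ψ α ws ag

star-∈ : ∀ ψ {C} G → C ∈ G → anyᵇ (isTrue ψ) C ≡ false → filterᵇ (notFalse ψ) C ∈ ψ * G
star-∈ ψ (C ∷ G) (here refl) none rewrite none = here refl
star-∈ ψ (D ∷ G) (there C∈G) none with anyᵇ (isTrue ψ) D
... | true = star-∈ ψ G C∈G none
... | false = there (star-∈ ψ G C∈G none)

-- At a stuck point ψ of X₀(F), every XOR-clause of F with at most one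
-- ψ-free variable is satisfied by every extension of ψ: otherwise the
-- falsifier would leave an empty or unit clause in ψ * X₀(F).
AtMostOne : List Var → Set
AtMostOne ws = (ws ≡ []) ⊎ (Σ Var λ u → ws ≡ [ u ])

few-free-sat : ∀ F ψ → Stuck (ψ * X₀ F) → ∀ {C} → C ∈ F → AtMostOne (freeVars ψ C) →
               ∀ α → Agree α ψ → SatX α C
few-free-sat F ψ stuck {C} C∈F few α ag with parity α (varsC C) ≟ᵇ negParity C
... | yes sat = sat
... | no unsat = ⊥-elim (excluded few)
  where
  reduct∈ : falsifier α (freeVars ψ C) ∈ ψ * X₀ F
  reduct∈ = subst (_∈ ψ * X₀ F) (falsifier-star ψ α (varsC C) ag)
    (star-∈ ψ (X₀ F) (X₀C⊆X₀ F C∈F (falsifier-∈-X₀C α C unsat)) (falsifier-not-true ψ α (varsC C) ag))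
  excluded : ¬ AtMostOne (freeVars ψ C)
  excluded (inj₁ none) = stuck-no-empty stuck (subst (λ ws → falsifier α ws ∈ ψ * X₀ F) none reduct∈)
  excluded (inj₂ (u , one)) = stuck-no-unit stuck (subst (λ ws → falsifier α ws ∈ ψ * X₀ F) one reduct∈)

update : (Var → Bool) → Var → Bool → Var → Bool
update α u c w = if u ≡ᵇ w then c else α w

update-same : ∀ α u c → update α u c u ≡ c
update-same α u c rewrite ≡ᵇ-refl u = refl

update-other : ∀ α u c {w} → u ≢ w → update α u c w ≡ α w
update-other α u c {w} u≢w rewrite ≡ᵇ-false u w u≢w = refl

parity-adjust : ∀ α u vs → Unique vs → u ∈ vs → ∀ t → Σ Bool λ c → parity (update α u c) vs ≡ t
parity-adjust α u (u ∷ ws) (u∉ws ∷ _) (here refl) t = t xor parity α ws , (begin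
  update α u c u xor parity (update α u c) ws
    ≡⟨ cong₂ _xor_ (update-same α u c) (parity-cong _ α ws (λ w∈ → update-other α u c (All.lookup u∉ws w∈))) ⟩
  (t xor parity α ws) xor parity α ws
    ≡⟨ xor-assoc t _ _ ⟩
  t xor (parity α ws xor parity α ws)
    ≡⟨ cong (t xor_) (xor-same (parity α ws)) ⟩
  t xor false
    ≡⟨ xor-identityʳ t ⟩
  t ∎)
  where
  c : Bool
  c = t xor parity α ws
parity-adjust α u (w ∷ ws) (w∉ws ∷ uniq) (there u∈ws) t with parity-adjust α u ws uniq u∈ws (α w xor t)
... | c , p = c , (begin
  update α u c w xor parity (update α u c) ws
    ≡⟨ cong₂ _xor_ (update-other α u c (λ { refl → All.lookup w∉ws u∈ws refl })) p ⟩
  α w xor (α w xor t)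
    ≡⟨ sym (xor-assoc (α w) (α w) t) ⟩
  (α w xor α w) xor t
    ≡⟨ cong (_xor t) (xor-same (α w)) ⟩
  t ∎)

head-var-fresh : ∀ v s C → IsClause ((v , s) ∷ C) → ∀ {y} → y ∈ C → v ≢ var y
head-var-fresh v true C (lit∉C ∷ _ , _) {_ , true} y∈C refl = All.lookup lit∉C y∈C refl
head-var-fresh v false C (lit∉C ∷ _ , _) {_ , false} y∈C refl = All.lookup lit∉C y∈C refl
head-var-fresh v true C (_ , no-pair) {_ , false} y∈C refl = no-pair v (here refl , there y∈C)
head-var-fresh v false C (_ , no-pair) {_ , true} y∈C refl = no-pair v (there y∈C , here refl)

vars-unique : ∀ C → IsClause C → Unique (varsC C)
vars-unique [] _ = []
vars-unique ((v , s) ∷ C) cl@(_ ∷ uniq , no-pair) =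
  All.map⁺ (All.tabulate (head-var-fresh v s C cl))
  ∷ vars-unique C (uniq , λ w (p , n) → no-pair w (there p , there n))

module _ {A : Set} where

  nth : List A → ℕ → Maybe A
  nth [] _ = nothing
  nth (x ∷ xs) zero = just x
  nth (x ∷ xs) (suc l) = nth xs l

  nth-lookup : ∀ (xs : List A) i → nth xs (toℕ i) ≡ just (lookup xs i)
  nth-lookup (x ∷ xs) fzero = refl
  nth-lookup (x ∷ xs) (Fin.suc i) = nth-lookup xs i

  nth-++ˡ : ∀ (xs ys : List A) {l} → l < length xs → nth (xs ++ ys) l ≡ nth xs l
  nth-++ˡ (x ∷ xs) ys {zero} _ = refl
  nth-++ˡ (x ∷ xs) ys {suc l} (s≤s l<) = nth-++ˡ xs ys l<

  nth-last : ∀ (xs : List A) y → nth (xs ++ [ y ]) (length xs) ≡ just y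
  nth-last [] y = refl
  nth-last (x ∷ xs) y = nth-last xs y

  nth-∈ : ∀ (xs : List A) l {a} → nth xs l ≡ just a → a ∈ xs
  nth-∈ (x ∷ xs) zero refl = here refl
  nth-∈ (x ∷ xs) (suc l) e = there (nth-∈ xs l e)

  nth-unique : ∀ (xs : List A) → Unique xs → ∀ l l' {a} → nth xs l ≡ just a → nth xs l' ≡ just a → l ≡ l'
  nth-unique (x ∷ xs) _ zero zero _ _ = refl
  nth-unique (x ∷ xs) (x∉ ∷ _) zero (suc l') refl e' = ⊥-elim (All.lookup x∉ (nth-∈ xs l' e') refl)
  nth-unique (x ∷ xs) (x∉ ∷ _) (suc l) zero e refl = ⊥-elim (All.lookup x∉ (nth-∈ xs l e) refl)
  nth-unique (x ∷ xs) (_ ∷ uniq) (suc l) (suc l') e e' = cong suc (nth-unique xs uniq l l' e e')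

  lookup-injective : ∀ (xs : List A) → Unique xs → ∀ {i j} → lookup xs i ≡ lookup xs j → i ≡ j
  lookup-injective xs uniq {i} {j} e = toℕ-injective
    (nth-unique xs uniq (toℕ i) (toℕ j) (trans (nth-lookup xs i) (cong just e)) (nth-lookup xs j))

  nth-cyclic : ∀ y M (i : Fin (length (y ∷ M))) →
               nth ((y ∷ M) ++ [ y ]) (suc (toℕ i)) ≡ just (lookup (y ∷ M) (suc (toℕ i) mod length (y ∷ M)))
  nth-cyclic y M i with m≤n⇒m<n∨m≡n (toℕ<n i)
  ... | inj₁ i+1<k = begin
    nth (L ++ [ y ]) (suc (toℕ i))          ≡⟨ nth-++ˡ L [ y ] i+1<k ⟩
    nth L (suc (toℕ i))                     ≡⟨ cong (nth L) (sym (trans (toℕ-fromℕ< _) (m<n⇒m%n≡m i+1<k))) ⟩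
    nth L (toℕ (suc (toℕ i) mod k))         ≡⟨ nth-lookup L (suc (toℕ i) mod k) ⟩
    just (lookup L (suc (toℕ i) mod k))     ∎
    where
    L : List A
    L = y ∷ M
    k : ℕ
    k = length L
  ... | inj₂ i+1≡k = begin
    nth (L ++ [ y ]) (suc (toℕ i))          ≡⟨ cong (nth (L ++ [ y ])) i+1≡k ⟩
    nth (L ++ [ y ]) (length L)             ≡⟨ nth-last L y ⟩
    just (lookup L fzero)                   ≡⟨ cong (just ∘ lookup L) (sym wraps) ⟩
    just (lookup L (suc (toℕ i) mod k))     ∎
    where
    L : List A
    L = y ∷ M
    k : ℕ
    k = length L
    wraps : suc (toℕ i) mod k ≡ fzero
    wraps = toℕ-injective (trans (toℕ-fromℕ< _) (trans (cong (_% k) i+1≡k) (n%n≡0 k)))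

  length-snoc : ∀ (xs : List A) y → length (xs ++ [ y ]) ≡ suc (length xs)
  length-snoc [] y = refl
  length-snoc (x ∷ xs) y = cong suc (length-snoc xs y)

  unique-prefix : ∀ (xs ys : List A) → Unique (xs ++ ys) → Unique xs
  unique-prefix [] ys _ = []
  unique-prefix (x ∷ xs) ys (x∉ ∷ uniq) = All.tabulate (All.lookup x∉ ∘ ∈-++⁺ˡ) ∷ unique-prefix xs ys uniq

  unique-rotate : ∀ (P : List A) x R → Unique (P ++ x ∷ R) → Unique (x ∷ P)
  unique-rotate P x R uniq = All.tabulate (x∉P P uniq) ∷ unique-prefix P (x ∷ R) uniq
    where
    x∉P : ∀ P → Unique (P ++ x ∷ R) → ∀ {z} → z ∈ P → x ≢ z
    x∉P (p ∷ P') (p∉ ∷ _) (here refl) refl = All.lookup p∉ (∈-++⁺ʳ P' (here refl)) refl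
    x∉P (p ∷ P') (_ ∷ uniq') (there z∈P') = x∉P P' uniq' z∈P'

unique-length : ∀ {n} (xs : List (Fin n)) → Unique xs → length xs ≤ n
unique-length xs uniq = injective⇒≤ (lookup-injective xs uniq)

module Incidence (F : ClauseSet) where

  Idx : Set
  Idx = Fin (length F)

  Vars : Idx → List Var
  Vars i = varsC (lookup F i)

  -- A walk, listed from its current end backwards; consecutive vertices
  -- lie in the clause between them.
  data Walk : List Var → List Idx → Set where
    start : ∀ x → Walk [ x ] []
    step : ∀ {x xs ds} d y → x ∈ Vars d → y ∈ Vars d → Walk (x ∷ xs) ds → Walk (y ∷ x ∷ xs) (d ∷ ds)

  walk-length : ∀ {Vs Ds} → Walk Vs Ds → length Vs ≡ suc (length Ds)
  walk-length (start x) = refl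
  walk-length (step d y _ _ w) = cong suc (walk-length w)

  walk-edge : ∀ {Vs Ds} → Walk Vs Ds → ∀ l {d} → nth Ds l ≡ just d →
              Σ Var λ a → Σ Var λ b → nth Vs l ≡ just a × nth Vs (suc l) ≡ just b × a ∈ Vars d × b ∈ Vars d
  walk-edge (step {x} d y x∈ y∈ w) zero refl = y , x , refl , refl , y∈ , x∈
  walk-edge (step d y _ _ w) (suc l) e = walk-edge w l e

  walk-head : ∀ {w Vs d Ds} → Walk (w ∷ Vs) (d ∷ Ds) → w ∈ Vars d
  walk-head (step d y _ y∈ _) = y∈

  step-onto : ∀ {R Ds} d y x' xs' P x → x' ∷ xs' ≡ P ++ x ∷ R → x' ∈ Vars d → y ∈ Vars d →
              Walk (P ++ [ x ]) Ds → Walk (y ∷ P ++ [ x ]) (d ∷ Ds)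
  step-onto d y x' xs' [] x refl x'∈ y∈ w = step d y x'∈ y∈ w
  step-onto d y x' xs' (p ∷ P) x refl x'∈ y∈ w = step d y x'∈ y∈ w

  cut-at-vertex : ∀ {Vs Ds x} → Walk Vs Ds → x ∈ Vs →
    Σ (List Var) λ P → Σ (List Var) λ R → Σ (List Idx) λ Es → Σ (List Idx) λ Rs →
    Vs ≡ P ++ x ∷ R × Ds ≡ Es ++ Rs × Walk (P ++ [ x ]) Es
  cut-at-vertex (start z) (here refl) = [] , [] , [] , [] , refl , refl , start z
  cut-at-vertex (step {x'} {xs} {ds} d y _ _ w) (here refl) = [] , x' ∷ xs , [] , d ∷ ds , refl , refl , start y
  cut-at-vertex {x = x} (step {x'} {xs} d y x'∈ y∈ w) (there x∈) with cut-at-vertex w x∈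
  ... | P , R , Es , Rs , eV , eD , w' =
    y ∷ P , R , d ∷ Es , Rs , cong (y ∷_) eV , cong (d ∷_) eD , step-onto d y x' xs P x eV x'∈ y∈ w'

  cut-at-clause : ∀ {Vs Ds c} → Walk Vs Ds → c ∈ Ds →
    Σ (List Var) λ Q → Σ Var λ y → Σ (List Var) λ R → Σ (List Idx) λ Es → Σ (List Idx) λ Rs →
    Vs ≡ Q ++ y ∷ R × Ds ≡ Es ++ c ∷ Rs × y ∈ Vars c × Walk (Q ++ [ y ]) Es
  cut-at-clause (step {x'} {xs} {ds} d y _ y∈ w) (here refl) = [] , y , x' ∷ xs , [] , ds , refl , refl , y∈ , start y
  cut-at-clause (step {x'} {xs} d y' x'∈ y'∈ w) (there c∈) with cut-at-clause w c∈
  ... | Q , y , R , Es , Rs , eV , eD , y∈c , w' =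
    y' ∷ Q , y , R , d ∷ Es , Rs , cong (y' ∷_) eV , cong (d ∷_) eD , y∈c , step-onto d y' x' xs Q y eV x'∈ y'∈ w'

  record ClosedWalk : Set where
    field
      y : Var
      m₁ : Var
      M' : List Var
      Es : List Idx
      walk : Walk (y ∷ m₁ ∷ M' ++ [ y ]) Es
      distinct-vertices : Unique (y ∷ m₁ ∷ M')
      distinct-clauses : Unique Es

  closedWalk⇒cycle : ClosedWalk → Cycle F
  closedWalk⇒cycle cw = record
    { m = length M'
    ; vs = lookup L
    ; cs = λ i → lookup Es (cast k≡ i)
    ; vs-inj = lookup-injective L distinct-vertices
    ; cs-inj = λ {i} {j} e → toℕ-injective (begin
        toℕ i                ≡⟨ sym (toℕ-cast k≡ i) ⟩
        toℕ (cast k≡ i)      ≡⟨ cong toℕ (lookup-injective Es distinct-clauses e) ⟩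
        toℕ (cast k≡ j)      ≡⟨ toℕ-cast k≡ j ⟩
        toℕ j                ∎)
    ; inl = inl
    ; inr = inr
    }
    where
    open ClosedWalk cw
    L : List Var
    L = y ∷ m₁ ∷ M'
    k : ℕ
    k = suc (suc (length M'))
    k≡ : k ≡ length Es
    k≡ = suc-injective (trans (sym (length-snoc L y)) (walk-length walk))
    nth-Es : ∀ (i : Fin k) → nth Es (toℕ i) ≡ just (lookup Es (cast k≡ i))
    nth-Es i = trans (cong (nth Es) (sym (toℕ-cast k≡ i))) (nth-lookup Es (cast k≡ i))
    inl : ∀ i → lookup L i ∈ Vars (lookup Es (cast k≡ i))
    inl i with walk-edge walk (toℕ i) (nth-Es i)
    ... | a , _ , nth-a , _ , a∈ , _ = subst (_∈ Vars (lookup Es (cast k≡ i)))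
      (just-injective (trans (sym nth-a) (trans (nth-++ˡ L [ y ] (toℕ<n i)) (nth-lookup L i)))) a∈
    inr : ∀ i → lookup L (suc (toℕ i) mod k) ∈ Vars (lookup Es (cast k≡ i))
    inr i with walk-edge walk (toℕ i) (nth-Es i)
    ... | _ , b , _ , nth-b , _ , b∈ =
      subst (_∈ Vars (lookup Es (cast k≡ i))) (just-injective (trans (sym nth-b) (nth-cyclic y (m₁ ∷ M') i))) b∈

  -- The end w of a walk lies in an earlier clause c of the walk: going
  -- back through c closes up the walk.
  close-via-clause : ∀ {w Vs d Ds c} → Walk (w ∷ Vs) (d ∷ Ds) → Unique (w ∷ Vs) → Unique (d ∷ Ds) →
                     c ∈ Ds → w ∈ Vars c → ClosedWalk
  close-via-clause {w} {Vs} {d} {Ds} {c} walk uV uD@(d∉Ds ∷ _) c∈Ds w∈c with cut-at-clause walk (there c∈Ds)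
  ... | Q , y , R , Es , Rs , eV , eD , y∈c , walk' = close Q Es eV eD walk'
    where
    close : ∀ Q Es → w ∷ Vs ≡ Q ++ y ∷ R → d ∷ Ds ≡ Es ++ c ∷ Rs → Walk (Q ++ [ y ]) Es → ClosedWalk
    close Q [] _ eD _ = ⊥-elim (All.lookup d∉Ds c∈Ds (∷-injectiveˡ eD))
    close [] (_ ∷ _) _ _ walk' with walk-length walk'
    ... | ()
    close (q ∷ Q') (e ∷ Es') refl eD walk' = record
      { y = y ; m₁ = w ; M' = Q' ; Es = c ∷ e ∷ Es'
      ; walk = step c y w∈c y∈c walk'
      ; distinct-vertices = unique-rotate (w ∷ Q') y R uV
      ; distinct-clauses = unique-rotate (e ∷ Es') c Rs (subst Unique eD uD) }

  close-via-vertex : ∀ {w Vs Ds c x} → Walk (w ∷ Vs) Ds → Unique (w ∷ Vs) → Unique Ds →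
                     ¬ c ∈ Ds → w ∈ Vars c → x ∈ Vs → x ∈ Vars c → ClosedWalk
  close-via-vertex {w} {Vs} {Ds} {c} {x} walk uV@(w∉Vs ∷ _) uD c∉Ds w∈c x∈Vs x∈c
    with cut-at-vertex walk (there x∈Vs)
  ... | P , R , Es , Rs , eV , eD , walk' = close P eV walk'
    where
    close : ∀ P → w ∷ Vs ≡ P ++ x ∷ R → Walk (P ++ [ x ]) Es → ClosedWalk
    close [] eV _ = ⊥-elim (All.lookup w∉Vs x∈Vs (∷-injectiveˡ eV))
    close (p ∷ P') refl walk' = record
      { y = x ; m₁ = w ; M' = P' ; Es = c ∷ Es
      ; walk = step c x w∈c x∈c walk'
      ; distinct-vertices = unique-rotate (w ∷ P') x R uV
      ; distinct-clauses = All.tabulate (λ c∈Es c≡ → c∉Ds (subst (_∈ Ds) (sym c≡) (subst (_ ∈_) (sym eD) (∈-++⁺ˡ c∈Es))))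
                           ∷ unique-prefix Es Rs (subst Unique eD uD) }

-- If every clause of A has two free variables and
-- A has no leaf, then walking from clause to clause through free variables
-- never gets stuck, so the incidence graph of F contains a closed walk.
module LeafSearch (F : ClauseSet) (free : Var → Bool) (v : Var) where
  open Incidence F

  private
    module ∈ᶠ = DecMembership (_≟ᶠ_ {length F})
    module ∈ⱽ = DecMembership _≟ℕ_

  Free : Var → Set
  Free u = free u ≡ true

  TwoFree : Idx → Set
  TwoFree i = Σ Var λ u₁ → Σ Var λ u₂ → u₁ ∈ Vars i × u₂ ∈ Vars i × Free u₁ × Free u₂ × u₁ ≢ u₂

  other-free : ∀ {c} → TwoFree c → ∀ w → Σ Var λ x → x ∈ Vars c × Free x × x ≢ w
  other-free (u₁ , u₂ , u₁∈ , u₂∈ , free₁ , free₂ , u₁≢u₂) w with u₁ ≟ℕ w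
  ... | yes refl = u₂ , u₂∈ , free₂ , u₁≢u₂ ∘ sym
  ... | no u₁≢w = u₁ , u₁∈ , free₁ , u₁≢w

  Shared : List Idx → Idx → Var → Set
  Shared A i u = Any (λ j → j ≢ i × u ∈ Vars j) A

  shared? : ∀ A i u → Dec (Shared A i u)
  shared? A i u = any? (λ j → ¬? (j ≟ᶠ i) ×-dec (u ∈ⱽ.∈? Vars j)) A

  Leaf : List Idx → Set
  Leaf A = Σ Idx λ i → Σ Var λ u → i ∈ A × u ∈ Vars i × Free u × u ≢ v × ¬ Shared A i u

  Leafless : List Idx → Set
  Leafless A = ∀ {i} → i ∈ A → ∀ {u} → u ∈ Vars i → Free u → u ≢ v → Shared A i u

  leaf-or-leafless : ∀ A → Leaf A ⊎ Leafless A
  leaf-or-leafless A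
    with any? (λ i → any? (λ u → (free u ≟ᵇ true) ×-dec ¬? (u ≟ℕ v) ×-dec ¬? (shared? A i u)) (Vars i)) A
  ... | yes has-leaf with find has-leaf
  ...   | i , i∈A , has-private with find has-private
  ...     | u , u∈ , free-u , u≢v , unshared = inj₁ (i , u , i∈A , u∈ , free-u , u≢v , unshared)
  leaf-or-leafless A | no no-leaf = inj₂ leafless
    where
    leafless : Leafless A
    leafless {i} i∈A {u} u∈ free-u u≢v with shared? A i u
    ... | yes shared = shared
    ... | no unshared = ⊥-elim (no-leaf (lose i∈A (lose u∈ (free-u , u≢v , unshared))))

  -- The walk starts at x₀; either x₀ = v or v is not a free variable of any
  -- clause of A, so the walk never visits v again.
  module Walking (A : List Idx) (two-free : All TwoFree A) (leafless : Leafless A) (x₀ : Var)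
                 (start-ok : (x₀ ≡ v) ⊎ (∀ {j} → j ∈ A → v ∈ Vars j → ¬ Free v)) where

    fresh≢v : ∀ {x c} → x ≢ x₀ → x ∈ Vars c → c ∈ A → Free x → x ≢ v
    fresh≢v {x} {c} x≢x₀ x∈c c∈A free-x x≡v = [ x₀-is-v , v-not-free ]′ start-ok
      where
      x₀-is-v : x₀ ≡ v → ⊥
      x₀-is-v x₀≡v = x≢x₀ (trans x≡v (sym x₀≡v))
      v-not-free : (∀ {j} → j ∈ A → v ∈ Vars j → ¬ Free v) → ⊥
      v-not-free v-bound = v-bound c∈A (subst (_∈ Vars c) x≡v x∈c) (subst Free x≡v free-x)

    -- Extend a walk with distinct vertices and clauses, ending at a free
    -- vertex w ≠ v, until it closes up; it has at most length F clauses.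
    extend : ∀ fuel {w Vs d Ds} → Walk (w ∷ Vs) (d ∷ Ds) → Unique (w ∷ Vs) → Unique (d ∷ Ds) →
             d ∈ A → Free w → w ≢ v → x₀ ∈ Vs → suc (length F) ≤ length (d ∷ Ds) + fuel → ClosedWalk
    extend zero {d = d} {Ds} _ _ uD _ _ _ _ enough = ⊥-elim (1+n≰n (≤-trans
      (subst (suc (length F) ≤_) (+-identityʳ _) enough) (unique-length (d ∷ Ds) uD)))
    extend (suc fuel) {w} {Vs} {d} {Ds} walk uV uD d∈A free-w w≢v x₀∈ enough
      with find (leafless d∈A (walk-head walk) free-w w≢v)
    ... | c , c∈A , c≢d , w∈c with c ∈ᶠ.∈? (d ∷ Ds)
    ...   | yes (here c≡d) = ⊥-elim (c≢d c≡d)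
    ...   | yes (there c∈Ds) = close-via-clause walk uV uD c∈Ds w∈c
    ...   | no c∉ with other-free (All.lookup two-free c∈A) w
    ...     | x , x∈c , free-x , x≢w with x ∈ⱽ.∈? (w ∷ Vs)
    ...       | yes (here x≡w) = ⊥-elim (x≢w x≡w)
    ...       | yes (there x∈Vs) = close-via-vertex walk uV uD c∉ w∈c x∈Vs x∈c
    ...       | no x∉ = extend fuel (step c x w∈c x∈c walk)
                  (All.¬Any⇒All¬ _ x∉ ∷ uV) (All.¬Any⇒All¬ _ c∉ ∷ uD) c∈A free-x
                  (fresh≢v (λ x≡x₀ → x∉ (there (subst (_∈ Vs) (sym x≡x₀) x₀∈))) x∈c c∈A free-x)
                  (there x₀∈) (subst (suc (length F) ≤_) (+-suc (length (d ∷ Ds)) fuel) enough)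

    start-walk : ∀ {j₀} → x₀ ∈ Vars j₀ → j₀ ∈ A → ClosedWalk
    start-walk {j₀} x₀∈ j₀∈A with other-free (All.lookup two-free j₀∈A) x₀
    ... | x , x∈ , free-x , x≢x₀ =
      extend (length F) (step j₀ x x₀∈ x∈ (start x₀)) ((x≢x₀ ∷ []) ∷ [] ∷ []) ([] ∷ [])
             j₀∈A free-x (fresh≢v x≢x₀ x∈ j₀∈A free-x) (here refl) ≤-refl

  leafless-closedWalk : ∀ {A} → All TwoFree A → Leafless A → ∀ {i₀} → i₀ ∈ A → ClosedWalk
  leafless-closedWalk {A} two-free leafless {i₀} i₀∈A
    with (free v ≟ᵇ true) ×-dec any? (λ j → v ∈ⱽ.∈? Vars j) A
  ... | yes (_ , v-occurs) with find v-occurs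
  ...   | j , j∈A , v∈j = Walking.start-walk A two-free leafless v (inj₁ refl) v∈j j∈A
  leafless-closedWalk {A} two-free leafless {i₀} i₀∈A | no v-not-free-in-A
    with All.lookup two-free i₀∈A
  ... | u , _ , u∈ , _ = Walking.start-walk A two-free leafless u
          (inj₂ λ j∈A v∈j free-v → v-not-free-in-A (free-v , lose j∈A v∈j)) u∈ i₀∈A

module Extension (F : ClauseSet) (clauses : ∀ {C} → C ∈ F → IsClause C) (acyclic : Acyclic F)
                 (ψ : PAss) (v : Var) (b : Bool) (permits : Permits ψ v b) where
  open Incidence F
  open LeafSearch F (Unassigned ψ) v

  Solution : List Idx → Set
  Solution A = Σ (Var → Bool) λ α → Agree α ψ × α v ≡ b × All (λ i → SatX α (lookup F i)) A

  no-constraints : Solution []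
  no-constraints = complete ψ (λ _ → b) , complete-agrees ψ (λ _ → b) , v-value permits , []
    where
    v-value : Permits ψ v b → complete ψ (λ _ → b) v ≡ b
    v-value (inj₁ e) = complete-unassigned ψ (λ _ → b) e
    v-value (inj₂ e) = complete-assigned ψ (λ _ → b) e

  without : Idx → List Idx → List Idx
  without j = filter (λ i → ¬? (i ≟ᶠ j))

  update-agrees : ∀ α {u} c → Free u → Agree α ψ → Agree (update α u c) ψ
  update-agrees α {u} c free-u ag w d ψw = trans (update-other α u c u≢w) (ag w d ψw)
    where
    u≢w : u ≢ w
    u≢w refl with trans (sym free-u) (cong is-nothing ψw)
    ... | ()

  add-leaf : ∀ A {j u} → u ∈ Vars j → Free u → u ≢ v → ¬ Shared A j u →
             Solution (without j A) → Solution A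
  add-leaf A {j} {u} u∈j free-u u≢v unshared (α , ag , αv , sat)
    with parity-adjust α u (Vars j) (vars-unique _ (clauses (∈-lookup j))) u∈j (negParity (lookup F j))
  ... | c , j-sat = update α u c , update-agrees α c free-u ag , trans (update-other α u c u≢v) αv
                  , All.tabulate sat'
    where
    sat' : ∀ {i} → i ∈ A → SatX (update α u c) (lookup F i)
    sat' {i} i∈A with i ≟ᶠ j
    ... | yes refl = j-sat
    ... | no i≢j = trans (parity-cong _ α (Vars i) λ w∈i → update-other α u c λ { refl → unshared (lose i∈A (i≢j , w∈i)) })
                         (All.lookup sat (∈-filter⁺ (λ i → ¬? (i ≟ᶠ j)) i∈A i≢j))

  -- Clauses with two free variables are solved by induction on their
  -- number, removing a leaf clause each time; acyclicity guarantees a leaf.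
  solve : ∀ n A → length A ≤ n → All TwoFree A → Solution A
  solve _ [] _ _ = no-constraints
  solve (suc n) A@(_ ∷ _) len two-free with leaf-or-leafless A
  ... | inj₂ leafless = ⊥-elim (acyclic (closedWalk⇒cycle (leafless-closedWalk two-free leafless (here refl))))
  ... | inj₁ (j , u , j∈A , u∈j , free-u , u≢v , unshared) =
    add-leaf A u∈j free-u u≢v unshared (solve n (without j A) shorter (All.filter⁺ (λ i → ¬? (i ≟ᶠ j)) two-free))
    where
    shorter : length (without j A) ≤ n
    shorter = ≤-pred (≤-trans (filter-notAll (λ i → ¬? (i ≟ᶠ j)) A (lose j∈A λ j≢j → j≢j refl)) len)

  atLeastTwo : List Var → Bool
  atLeastTwo (_ ∷ _ ∷ _) = true
  atLeastTwo _ = false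

  manyFree : Idx → Bool
  manyFree i = atLeastTwo (freeVars ψ (lookup F i))

  manyFree⇒TwoFree : ∀ i → manyFree i ≡ true → TwoFree i
  manyFree⇒TwoFree i many = two (freeVars ψ (lookup F i)) refl
    (Unique.filter⁺ (T? ∘ Unassigned ψ) (vars-unique _ (clauses (∈-lookup i)))) many
    where
    two : ∀ ws → freeVars ψ (lookup F i) ≡ ws → Unique ws → atLeastTwo ws ≡ true → TwoFree i
    two (u₁ ∷ u₂ ∷ _) eq ((u₁≢u₂ ∷ _) ∷ _) _ with ∈-filterᵇ⁻ (Unassigned ψ) (Vars i) (subst (u₁ ∈_) (sym eq) (here refl))
                                                 | ∈-filterᵇ⁻ (Unassigned ψ) (Vars i) (subst (u₂ ∈_) (sym eq) (there (here refl)))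
    ... | u₁∈ , free₁ | u₂∈ , free₂ = u₁ , u₂ , u₁∈ , u₂∈ , free₁ , free₂ , u₁≢u₂

  fewFree : ∀ i → manyFree i ≡ false → AtMostOne (freeVars ψ (lookup F i))
  fewFree i few with freeVars ψ (lookup F i)
  ... | [] = inj₁ refl
  ... | u ∷ [] = inj₂ (u , refl)

  Many : List Idx
  Many = filterᵇ manyFree (allFin (length F))

  many-solution : Solution Many
  many-solution = solve (length Many) Many ≤-refl
    (All-filterᵇ manyFree {xs = allFin (length F)} λ {i} _ → manyFree⇒TwoFree i)

  -- the remaining clauses are satisfied automatically at a stuck point
  extension : Stuck (ψ * X₀ F) → Σ (Var → Bool) λ α → Models α (X₀ F) × Agree α ψ × α v ≡ b
  extension stuck with many-solution
  ... | α , ag , αv , sat-many = α , X₀-sound α F sat , ag , αv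
    where
    sat-at : ∀ i → SatX α (lookup F i)
    sat-at i with manyFree i in many
    ... | true = All.lookup sat-many (∈-filterᵇ⁺ manyFree (∈-allFin i) many)
    ... | false = few-free-sat F ψ stuck (∈-lookup i) (fewFree i many) α ag
    sat : ∀ {C} → C ∈ F → SatX α C
    sat C∈F = subst (SatX α) (sym (lookup-index C∈F)) (sat-at (Any.index C∈F))

free-extension : ∀ F → (∀ {C} → C ∈ F → IsClause C) → Acyclic F →
                 ∀ ψ → Stuck (ψ * X₀ F) → FreelyExtendable (X₀ F) ψ
free-extension F clauses acyclic ψ stuck v b permits =
  Extension.extension F clauses acyclic ψ v b permits stuck

lemma7p1 : (F : ClauseSet) → (∀ {C} → C ∈ F → IsClause C) → Acyclic F → PC (X₀ F)
lemma7p1 F clauses acyclic = PC-criterion (X₀ F) (free-extension F clauses acyclic)
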